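{- Let $\mathcal{P}=(\mathcal{E},D,c,f_c)$ be a combinatorial sum problem, $E\subseteq\mathcal{E}$, and let $E_1,\dots,E_m$ be an arbitrary partition of $E$ (pairwise disjoint sets with $E=\bigcup_{i=1}^mE_i$). Then $l'_{\mathcal{P}}(E)\le\sum_{i=1}^m l'_{\mathcal{P}}(E_i)$.
   Context: A combinatorial sum problem (CSP) is a tuple $\mathcal{P}=(\mathcal{E},D,c,f_c)$, where $\mathcal{E}$ is a finite ground set, $D\subseteq 2^{\mathcal{E}}\setminus\{\emptyset\}$ is the set of feasible solutions, $c:\mathcal{E}\to\mathbb{R}$ and $f_c(S)=\sum_{e\in S}c(e)$ for $S\in D$; the optimal value is $c^\ast=\min_{S\in D}f_c(S)$. For $F=\{f_1,\dots,f_k\}\subseteq\mathcal{E}$ and $\vec\alpha=(\alpha_1,\dots,\alpha_k)\in\mathbb{R}^k$, $\mathcal{P}_{c_{ -\vec\alpha,F}}$ is the CSP with cost of $f_i$ changed to $c(f_i)-\alpha_i$ and all other costs unchanged; $f_{c_{ -\vec\alpha,F}}(\mathcal{P}_{c_{ -\vec\alpha,F}})$ denotes its optimal value. The set lower tolerance is $l'_{\mathcal{P}}(F)=\max\{\alpha\in\mathbb{R}:$ there exists $\vec\alpha$ with all $\alpha_i\ge0$, $\alpha=\sum_i\alpha_i$, $f_{c_{ -\vec\alpha,F}}(\mathcal{P}_{c_{ -\vec\alpha,F}})=c^\ast\}$, with value $\infty$ if this set is unbounded. -}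

module Defs where

open import Data.Nat using (ℕ; zero; suc)
open import Data.Fin using (Fin; zero; suc)
open import Data.Bool using (Bool; true; false; if_then_else_)
open import Data.Vec using (lookup)
open import Data.Fin.Subset using (Subset; _∈_; _∉_)
open import Data.Product using (Σ; ∃; _×_; _,_)
open import Relation.Binary.PropositionalEquality using (_≡_; _≢_)
open import Relation.Nullary using (¬_)
import Data.Unit
import Data.Empty
import Data.Sum

-- The real numbers, axiomatised as a Dedekind-complete ordered field
-- (which characterises ℝ up to isomorphism).  Equality is propositional.
record RealField : Set₁ where
  infixl 6 _+_ _-_
  infixl 7 _*_
  infix 4 _≤_
  field
    ℝ    : Set
    0ℝ 1ℝ : ℝ
    _+_ _*_ : ℝ → ℝ → ℝ
    -_   : ℝ → ℝ
    _≤_  : ℝ → ℝ → Set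
    +-assoc : ∀ x y z → (x + y) + z ≡ x + (y + z)
    +-comm  : ∀ x y → x + y ≡ y + x
    +-idˡ   : ∀ x → 0ℝ + x ≡ x
    +-invˡ  : ∀ x → (- x) + x ≡ 0ℝ
    *-assoc : ∀ x y z → (x * y) * z ≡ x * (y * z)
    *-comm  : ∀ x y → x * y ≡ y * x
    *-idˡ   : ∀ x → 1ℝ * x ≡ x
    distribʳ : ∀ x y z → (y + z) * x ≡ (y * x) + (z * x)
    0≢1     : 0ℝ ≢ 1ℝ
    *-inv   : ∀ x → x ≢ 0ℝ → ∃ λ y → x * y ≡ 1ℝ
    ≤-refl    : ∀ x → x ≤ x
    ≤-trans   : ∀ {x y z} → x ≤ y → y ≤ z → x ≤ z
    ≤-antisym : ∀ {x y} → x ≤ y → y ≤ x → x ≡ y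
    ≤-total   : ∀ x y → Data.Sum._⊎_ (x ≤ y) (y ≤ x)
    +-mono-≤  : ∀ {x y} z → x ≤ y → x + z ≤ y + z
    *-nonneg  : ∀ {x y} → 0ℝ ≤ x → 0ℝ ≤ y → 0ℝ ≤ x * y
    complete  : (P : ℝ → Set) → ∃ P → (∃ λ b → ∀ x → P x → x ≤ b) →
                ∃ λ s → (∀ x → P x → x ≤ s) × (∀ b → (∀ x → P x → x ≤ b) → s ≤ b)

  _-_ : ℝ → ℝ → ℝ
  x - y = x + (- y)

open import Data.Sum using (_⊎_)

data Ext (R : RealField) : Set where
  fin : RealField.ℝ R → Ext R
  ∞   : Ext R

module Theory (R : RealField) where
  open RealField R

  sumFin : (n : ℕ) → (Fin n → ℝ) → ℝ
  sumFin zero    g = 0ℝ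
  sumFin (suc n) g = g zero + sumFin n (λ i → g (suc i))

  f : {n : ℕ} → (Fin n → ℝ) → Subset n → ℝ
  f {n} c S = sumFin n (λ e → if lookup S e then c e else 0ℝ)

  Nonempty : {n : ℕ} → Subset n → Set
  Nonempty S = ∃ λ e → e ∈ S

  record CSP (n : ℕ) : Set₁ where
    field
      D       : Subset n → Set
      D-nonempty : ∀ S → D S → Nonempty S
      c       : Fin n → ℝ

  IsOptVal : {n : ℕ} → (Subset n → Set) → (Fin n → ℝ) → ℝ → Set
  IsOptVal D c v = (∃ λ S → D S × f c S ≡ v) × (∀ S → D S → v ≤ f c S)

  decrease : {n : ℕ} → (Fin n → ℝ) → Subset n → (Fin n → ℝ) → (Fin n → ℝ)
  decrease c F α e = if lookup F e then c e - α e else c e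

  -- a is an admissible total decrease for F (the set in the definition of l'),
  -- where c* is the optimal value of P.
  Admissible : {n : ℕ} → CSP n → ℝ → Subset n → ℝ → Set
  Admissible {n} P cstar F a =
    ∃ λ (α : Fin n → ℝ) → (∀ e → e ∈ F → 0ℝ ≤ α e)
        × (a ≡ f α F)
        × IsOptVal (CSP.D P) (decrease (CSP.c P) F α) cstar

  IsSetLowerTol : {n : ℕ} → CSP n → ℝ → Subset n → Ext R → Set
  IsSetLowerTol P cstar F (fin L) =
    Admissible P cstar F L × (∀ a → Admissible P cstar F a → a ≤ L)
  IsSetLowerTol P cstar F ∞ =
    ∀ b → ∃ λ a → Admissible P cstar F a × ¬ (a ≤ b)

  _≤ₑ_ : Ext R → Ext R → Set
  fin x ≤ₑ fin y = x ≤ y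
  fin x ≤ₑ ∞     = Data.Unit.⊤
  ∞     ≤ₑ fin y = Data.Empty.⊥
  ∞     ≤ₑ ∞     = Data.Unit.⊤

  _+ₑ_ : Ext R → Ext R → Ext R
  fin x +ₑ fin y = fin (x + y)
  fin x +ₑ ∞     = ∞
  ∞     +ₑ y     = ∞

  sumExt : (m : ℕ) → (Fin m → Ext R) → Ext R
  sumExt zero    g = fin 0ℝ
  sumExt (suc m) g = g zero +ₑ sumExt m (λ i → g (suc i))

  IsPartition : {n m : ℕ} → Subset n → (Fin m → Subset n) → Set
  IsPartition {n} {m} E Es =
    (∀ (i j : Fin m) → i ≢ j → ∀ e → e ∈ Es i → e ∉ Es j)
    × (∀ e → e ∈ E → ∃ λ i → e ∈ Es i)
    × (∀ e i → e ∈ Es i → e ∈ E)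

{-# OPTIONS --safe #-}
-- If α witnesses that the costs on E can be lowered by a total of a without
-- changing the optimal value c*, then lowering only the costs on one block Eᵢ
-- by the same α does not change it either: those costs lie pointwise between
-- c_{-α,E} and c, and both of these have optimal value c*.  Hence the total
-- of α on Eᵢ is admissible for Eᵢ and at most l'(Eᵢ), and since the Eᵢ
-- partition E these totals add up to a.
module Submission where

open import Defs
open import Algebra.Bundles using (CommutativeMonoid)
import Algebra.Properties.CommutativeMonoid.Sum as CommutativeMonoidSum
import Algebra.Structures.Biased as Biased
open import Data.Nat using (ℕ; zero; suc)
open import Data.Fin using (Fin; zero; suc; punchIn)
open import Data.Fin.Properties using (punchInᵢ≢i)
open import Data.Fin.Subset using (Subset; _∈_; _∉_; _⊆_)
open import Data.Fin.Subset.Properties using (_∈?_)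
open import Data.Bool using (true; false; if_then_else_)
open import Data.Vec using (lookup)
open import Data.Vec.Properties using ([]=⇒lookup; lookup⇒[]=)
open import Data.Product using (_,_)
open import Data.Unit using (tt)
open import Function using (_∘_)
open import Relation.Nullary using (yes; no; contradiction)
open import Relation.Binary.PropositionalEquality

module Tolerance (R : RealField) where
  open RealField R renaming (+-mono-≤ to +-monoˡ-≤)
  open Theory R

  +-commutativeMonoid : CommutativeMonoid _ _
  +-commutativeMonoid = record
    { isCommutativeMonoid = Biased.isCommutativeMonoidˡ record
      { isSemigroup = record
        { isMagma = record { isEquivalence = isEquivalence ; ∙-cong = cong₂ _+_ }
        ; assoc   = +-assoc
        }
      ; identityˡ = +-idˡ
      ; comm      = +-comm
      }
    }

  open CommutativeMonoid +-commutativeMonoid using () renaming (identityʳ to +-idʳ)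
  open CommutativeMonoidSum +-commutativeMonoid
    using (sum; sum-cong-≗; sum-replicate-zero; sum-remove; ∑-comm)

  sumFin≡sum : ∀ n (g : Fin n → ℝ) → sumFin n g ≡ sum g
  sumFin≡sum zero    g = refl
  sumFin≡sum (suc n) g = cong (g zero +_) (sumFin≡sum n (g ∘ suc))

  sum-zero : ∀ {m} (h : Fin m → ℝ) → (∀ j → h j ≡ 0ℝ) → sum h ≡ 0ℝ
  sum-zero {m} h h≡0 = trans (sum-cong-≗ h≡0) (sum-replicate-zero m)

  sum-concentrated : ∀ {m} (h : Fin m → ℝ) i → (∀ j → j ≢ i → h j ≡ 0ℝ) → sum h ≡ h i
  sum-concentrated {suc m} h i h≡0 = begin
    sum h                              ≡⟨ sum-remove {i = i} h ⟩
    h i + sum (h ∘ punchIn i)          ≡⟨ cong (h i +_) (sum-zero _ λ j → h≡0 _ (punchInᵢ≢i i j)) ⟩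
    h i + 0ℝ                           ≡⟨ +-idʳ (h i) ⟩
    h i                                ∎
    where open ≡-Reasoning

  +-mono-≤ : ∀ {x y u v} → x ≤ y → u ≤ v → x + u ≤ y + v
  +-mono-≤ {x} {y} {u} {v} x≤y u≤v =
    ≤-trans (+-monoˡ-≤ u x≤y) (subst₂ _≤_ (+-comm u y) (+-comm v y) (+-monoˡ-≤ y u≤v))

  x-a≤x : ∀ x {a} → 0ℝ ≤ a → x - a ≤ x
  x-a≤x x {a} 0≤a = subst₂ _≤_ (+-idʳ (x - a)) x-a+a≡x (+-mono-≤ (≤-refl (x - a)) 0≤a)
    where
    open ≡-Reasoning
    x-a+a≡x : (x - a) + a ≡ x
    x-a+a≡x = begin
      (x + - a) + a  ≡⟨ +-assoc x (- a) a ⟩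
      x + (- a + a)  ≡⟨ cong (x +_) (+-invˡ a) ⟩
      x + 0ℝ         ≡⟨ +-idʳ x ⟩
      x              ∎

  sumFin-mono-≤ : ∀ n {g h : Fin n → ℝ} → (∀ i → g i ≤ h i) → sumFin n g ≤ sumFin n h
  sumFin-mono-≤ zero    g≤h = ≤-refl 0ℝ
  sumFin-mono-≤ (suc n) g≤h = +-mono-≤ (g≤h zero) (sumFin-mono-≤ n (g≤h ∘ suc))

  mask : ∀ {n} → Subset n → (Fin n → ℝ) → Fin n → ℝ
  mask S c e = if lookup S e then c e else 0ℝ

  mask-∈ : ∀ {n} {S : Subset n} {e} (c : Fin n → ℝ) → e ∈ S → mask S c e ≡ c e
  mask-∈ c e∈S rewrite []=⇒lookup e∈S = refl

  mask-∉ : ∀ {n} {S : Subset n} {e} (c : Fin n → ℝ) → e ∉ S → mask S c e ≡ 0ℝ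
  mask-∉ {S = S} {e} c e∉S with lookup S e in eq
  ... | true  = contradiction (lookup⇒[]= e S eq) e∉S
  ... | false = refl

  f-mono-≤ : ∀ {n} (S : Subset n) {c₁ c₂ : Fin n → ℝ} → (∀ e → c₁ e ≤ c₂ e) → f c₁ S ≤ f c₂ S
  f-mono-≤ {n} S {c₁} {c₂} c₁≤c₂ = sumFin-mono-≤ n pointwise
    where
    pointwise : ∀ e → mask S c₁ e ≤ mask S c₂ e
    pointwise e with lookup S e
    ... | true  = c₁≤c₂ e
    ... | false = ≤-refl 0ℝ

  IsOptVal-squeeze : ∀ {n} {D : Subset n → Set} {c₁ c₂ c₃ : Fin n → ℝ} {v} →
    (∀ e → c₁ e ≤ c₂ e) → (∀ e → c₂ e ≤ c₃ e) →
    IsOptVal D c₁ v → IsOptVal D c₃ v → IsOptVal D c₂ v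
  IsOptVal-squeeze {D = D} {c₂ = c₂} {v = v} c₁≤c₂ c₂≤c₃ (_ , v≤f₁) ((S , S∈D , f₃S≡v) , _) =
    (S , S∈D , ≤-antisym (subst (f c₂ S ≤_) f₃S≡v (f-mono-≤ S c₂≤c₃)) (v≤f₂ S S∈D)) , v≤f₂
    where
    v≤f₂ : ∀ T → D T → v ≤ f c₂ T
    v≤f₂ T T∈D = ≤-trans (v≤f₁ T T∈D) (f-mono-≤ T c₁≤c₂)

  NonnegOn : ∀ {n} → Subset n → (Fin n → ℝ) → Set
  NonnegOn F α = ∀ e → e ∈ F → 0ℝ ≤ α e

  decrease-≤ : ∀ {n} (c : Fin n → ℝ) {F α} → NonnegOn F α → ∀ e → decrease c F α e ≤ c e
  decrease-≤ c {F} α≥0 e with lookup F e in eq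
  ... | true  = x-a≤x (c e) (α≥0 e (lookup⇒[]= e F eq))
  ... | false = ≤-refl (c e)

  decrease-antitone : ∀ {n} (c : Fin n → ℝ) {F₁ F α} → NonnegOn F α → F₁ ⊆ F →
    ∀ e → decrease c F α e ≤ decrease c F₁ α e
  decrease-antitone c {F₁} {F} α≥0 F₁⊆F e with lookup F₁ e in eq₁ | lookup F e in eq
  ... | true  | true  = ≤-refl _
  ... | true  | false = contradiction (trans (sym ([]=⇒lookup (F₁⊆F (lookup⇒[]= e F₁ eq₁)))) eq) λ ()
  ... | false | true  = x-a≤x (c e) (α≥0 e (lookup⇒[]= e F eq))
  ... | false | false = ≤-refl _

  admissible-⊆ : ∀ {n} (P : CSP n) {cstar} {F₁ F : Subset n} (α : Fin n → ℝ) →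
    IsOptVal (CSP.D P) (CSP.c P) cstar → F₁ ⊆ F → NonnegOn F α →
    IsOptVal (CSP.D P) (decrease (CSP.c P) F α) cstar →
    Admissible P cstar F₁ (f α F₁)
  admissible-⊆ P α opt F₁⊆F α≥0 optF =
    α , (λ e → α≥0 e ∘ F₁⊆F) , refl ,
    IsOptVal-squeeze (decrease-antitone (CSP.c P) α≥0 F₁⊆F)
                     (decrease-≤ (CSP.c P) (λ e → α≥0 e ∘ F₁⊆F)) optF opt

  mask-partition : ∀ {n m} {E : Subset n} {Es : Fin m → Subset n} → IsPartition E Es →
    ∀ c e → mask E c e ≡ sum (λ i → mask (Es i) c e)
  mask-partition {E = E} {Es} (disjoint , covers , _) c e with e ∈? E
  ... | yes e∈E = let (i , e∈Eᵢ) = covers e e∈E in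
    trans (mask-∈ c e∈E) (sym (trans
      (sum-concentrated _ i λ j j≢i → mask-∉ c (disjoint i j (≢-sym j≢i) e e∈Eᵢ))
      (mask-∈ c e∈Eᵢ)))
  mask-partition (_ , _ , ⊆E) c e | no e∉E =
    trans (mask-∉ c e∉E) (sym (sum-zero _ λ j → mask-∉ c (e∉E ∘ ⊆E e j)))

  f-partition : ∀ {n m} {E : Subset n} {Es : Fin m → Subset n} → IsPartition E Es →
    ∀ α → f α E ≡ sumFin m (λ i → f α (Es i))
  f-partition {n} {m} {E} {Es} partition α = begin
    f α E                                  ≡⟨ sumFin≡sum n _ ⟩
    sum (mask E α)                         ≡⟨ sum-cong-≗ (mask-partition partition α) ⟩
    sum (λ e → sum (λ i → mask (Es i) α e)) ≡⟨ ∑-comm (λ e i → mask (Es i) α e) ⟩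
    sum (λ i → sum (mask (Es i) α))        ≡⟨ sum-cong-≗ (λ i → sumFin≡sum n (mask (Es i) α)) ⟨
    sum (λ i → f α (Es i))                 ≡⟨ sumFin≡sum m _ ⟨
    sumFin m (λ i → f α (Es i))            ∎
    where open ≡-Reasoning

  +ₑ-mono-≤ : ∀ {u v} A B → fin u ≤ₑ A → fin v ≤ₑ B → fin (u + v) ≤ₑ (A +ₑ B)
  +ₑ-mono-≤ (fin x) (fin y) u≤x v≤y = +-mono-≤ u≤x v≤y
  +ₑ-mono-≤ (fin x) ∞       _   _   = tt
  +ₑ-mono-≤ ∞       B       _   _   = tt

  sumFin-≤-sumExt : ∀ m {a : Fin m → ℝ} (Ls : Fin m → Ext R) →
    (∀ i → fin (a i) ≤ₑ Ls i) → fin (sumFin m a) ≤ₑ sumExt m Ls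
  sumFin-≤-sumExt zero    Ls a≤L = ≤-refl 0ℝ
  sumFin-≤-sumExt (suc m) Ls a≤L =
    +ₑ-mono-≤ (Ls zero) (sumExt m (Ls ∘ suc)) (a≤L zero) (sumFin-≤-sumExt m (Ls ∘ suc) (a≤L ∘ suc))

  admissible-≤-tol : ∀ {n} {P : CSP n} {cstar F L a} →
    IsSetLowerTol P cstar F L → Admissible P cstar F a → fin a ≤ₑ L
  admissible-≤-tol {L = fin L} (_ , maximal) adm = maximal _ adm
  admissible-≤-tol {L = ∞}     _             _   = tt

  tol-least : ∀ {n} {P : CSP n} {cstar F L} (X : Ext R) → IsSetLowerTol P cstar F L →
    (∀ a → Admissible P cstar F a → fin a ≤ₑ X) → L ≤ₑ X
  tol-least {L = fin L} X     (adm , _) bounded = bounded L adm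
  tol-least {L = ∞}     (fin x) unbounded bounded =
    let (a , adm , a≰x) = unbounded x in a≰x (bounded a adm)
  tol-least {L = ∞}     ∞     _         _       = tt

  admissible-≤-sumExt : ∀ {n m} (P : CSP n) {cstar E} {Es : Fin m → Subset n} {Ls a} →
    IsOptVal (CSP.D P) (CSP.c P) cstar → IsPartition E Es →
    (∀ i → IsSetLowerTol P cstar (Es i) (Ls i)) →
    Admissible P cstar E a → fin a ≤ₑ sumExt m Ls
  admissible-≤-sumExt {m = m} P {Ls = Ls} opt partition@(_ , _ , ⊆E) tol (α , α≥0 , refl , optE) =
    subst (λ x → fin x ≤ₑ sumExt m Ls) (sym (f-partition partition α))
      (sumFin-≤-sumExt m Ls λ i →
        admissible-≤-tol (tol i) (admissible-⊆ P α opt (⊆E _ i) α≥0 optE))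

theorem11 : (R : RealField) → (n : ℕ) → (P : Theory.CSP R n) → (cstar : RealField.ℝ R)
    → Theory.IsOptVal R (Theory.CSP.D P) (Theory.CSP.c P) cstar
    → (E : Subset n) → (m : ℕ) → (Es : Fin m → Subset n)
    → Theory.IsPartition R E Es
    → (L : Ext R) → Theory.IsSetLowerTol R P cstar E L
    → (Ls : Fin m → Ext R) → ((i : Fin m) → Theory.IsSetLowerTol R P cstar (Es i) (Ls i))
    → Theory._≤ₑ_ R L (Theory.sumExt R m Ls)
theorem11 R n P cstar opt E m Es partition L tolE Ls tol =
  tol-least (Theory.sumExt R m Ls) tolE λ _ → admissible-≤-sumExt P opt partition tol
  where open Tolerance R
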